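{- Let $(C_k)_{k\ge 0}$ be the Lucas-balancing sequence. Suppose that there exist positive integers $k, m, n$ with $n \ge 2$ and digits $d_1, d_2 \in \{1,2,\dots,9\}$ such that \[ C_k = d_1\left(\frac{10^n-1}{9}\right) - d_2\left(\frac{10^m-1}{9}\right), \] i.e. $C_k$ is the difference of the repdigit consisting of $n$ copies of the digit $d_1$ and the repdigit consisting of $m$ copies of the digit $d_2$. Then $C_k \in \{3, 17\}$. Both values occur: $C_1 = 3 = 11 - 8$ and $C_2 = 17 = 22 - 5$.
   Context: The Lucas-balancing sequence $(C_k)_{k\ge0}$ is defined by $C_0=1$, $C_1=3$ and $C_{k+1}=6C_k-C_{k-1}$ for $k\ge1$. A repdigit is a positive integer all of whose decimal digits are equal. A repdigit with $n$ digits all equal to $d\in\{1,\dots,9\}$ is $d(10^n-1)/9$. -}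

module Defs where

open import Data.Nat using (ℕ; zero; suc; _+_; _*_; _∸_; _^_)
open import Data.Nat.DivMod using (_/_)

-- Lucas-balancing sequence: C 0 = 1, C 1 = 3, C (k+2) = 6 C (k+1) - C k
-- (the sequence is increasing, so truncated subtraction is exact)
C : ℕ → ℕ
C zero = 1
C (suc zero) = 3
C (suc (suc k)) = 6 * C (suc k) ∸ C k

repdigit : ℕ → ℕ → ℕ
repdigit d n = d * ((10 ^ n ∸ 1) / 9)

{-# OPTIONS --safe #-}
module Submission where

open import Defs
open import Data.Nat using (ℕ; _≤_; _≥_)
open import Data.Integer using (ℤ; +_; _-_)
open import Data.Sum using (_⊎_)
open import Relation.Binary.PropositionalEquality using (_≡_)

open import Data.Bool using (Bool; true; false; T; _∧_; _∨_)
open import Data.Bool.Properties using (T-∧; T-∨)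
open import Data.Empty using (⊥-elim)
import Data.Integer as ℤ
import Data.Integer.Properties as ℤ
open import Algebra.Properties.AbelianGroup ℤ.+-0-abelianGroup using (//-rightDividesˡ)
open import Data.Nat using (zero; suc; pred; _+_; _*_; _∸_; _^_; _<_; _≡ᵇ_; z≤n; s≤s; z<s; s<s; NonZero)
open import Data.Nat.DivMod
open import Data.Nat.Divisibility using (_∣_; _∣0; divides; m∣m*n; ∣n⇒∣m*n; ∣m∣n⇒∣m+n)
open import Data.Nat.GeneralisedArithmetic using (fold; iterate; fold-+; iterate-is-fold)
open import Data.Nat.Properties
open import Data.Nat.Tactic.RingSolver using (solve-∀)
open import Data.Product using (_×_; _,_; proj₁; proj₂)
import Data.Product as Product
open import Data.Sum using (inj₁; inj₂)
import Data.Sum as Sum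
open import Function using (_∘_; Equivalence)
open import Relation.Binary.PropositionalEquality using (refl; sym; trans; cong; subst; subst₂; module ≡-Reasoning)

-- Clearing denominators turns the equation into 9 C_k + d₁ + d₂ 10^m = d₂ + d₁ 10^n.
-- Modulo M = 4510000 = 2⁴ 5⁴ 11 41 the pairs (C_k, C_{k+1}) repeat with period 1500,
-- and 10^e repeats with period 10 from e = 4 on (10 has order 10 modulo 451), so the
-- equation leaves finitely many congruences to check. All of them fail unless n = 2
-- and (d₁, d₂) is (1, 8) or (2, 5). Then d₁ < d₂ makes d₂ 10^m exceed d₂ + 100 d₁ as
-- soon as m ≥ 2, so m = 1 and C_k = 11 d₁ − d₂ is 3 or 17.

m∣[1+m]^n∸1 : ∀ m n → m ∣ suc m ^ n ∸ 1
m∣[1+m]^n∸1 m zero    = m ∣0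
m∣[1+m]^n∸1 m (suc n) =
  subst (m ∣_) (sym split) (∣m∣n⇒∣m+n (m∣m*n p) (m∣[1+m]^n∸1 m n))
  where
    open ≡-Reasoning
    p = suc m ^ n
    split : suc m * p ∸ 1 ≡ m * p + (p ∸ 1)
    split = begin
      suc m * p ∸ 1   ≡⟨ cong (_∸ 1) (+-comm p (m * p)) ⟩
      m * p + p ∸ 1   ≡⟨ +-∸-assoc (m * p) (m^n>0 (suc m) n) ⟩
      m * p + (p ∸ 1) ∎

9*repdigit+d≡d*10^n : ∀ d n → 9 * repdigit d n + d ≡ d * 10 ^ n
9*repdigit+d≡d*10^n d n = begin
  9 * (d * r) + d      ≡⟨ factor d r ⟩
  d * (9 * r + 1)      ≡⟨ cong (λ t → d * (t + 1)) (m*[n/m]≡n (m∣[1+m]^n∸1 9 n)) ⟩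
  d * (10 ^ n ∸ 1 + 1) ≡⟨ cong (d *_) (m∸n+n≡m (m^n>0 10 n)) ⟩
  d * 10 ^ n           ∎
  where
    open ≡-Reasoning
    r = (10 ^ n ∸ 1) / 9
    factor : ∀ d r → 9 * (d * r) + d ≡ d * (9 * r + 1)
    factor = solve-∀

+m≡+n-+o⇒m+o≡n : ∀ {m n o} → + m ≡ + n - + o → m + o ≡ n
+m≡+n-+o⇒m+o≡n {m} {n} {o} eq = ℤ.+-injective (begin
  + (m + o)             ≡⟨ ℤ.pos-+ m o ⟩
  + m ℤ.+ + o           ≡⟨ cong (ℤ._+ + o) eq ⟩
  (+ n - + o) ℤ.+ + o   ≡⟨ //-rightDividesˡ (+ o) (+ n) ⟩
  + n                   ∎)
  where open ≡-Reasoning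

repdigit-difference : ∀ x d₁ d₂ m n → + x ≡ + repdigit d₁ n - + repdigit d₂ m →
                      9 * x + d₁ + d₂ * 10 ^ m ≡ d₂ + d₁ * 10 ^ n
repdigit-difference x d₁ d₂ m n eq = begin
  9 * x + d₁ + d₂ * 10 ^ m    ≡⟨ cong (λ t → 9 * x + d₁ + t) (9*repdigit+d≡d*10^n d₂ m) ⟨
  9 * x + d₁ + (9 * r₂ + d₂)  ≡⟨ regroup x r₂ d₁ d₂ ⟩
  9 * (x + r₂) + d₁ + d₂      ≡⟨ cong (λ t → 9 * t + d₁ + d₂) (+m≡+n-+o⇒m+o≡n eq) ⟩
  9 * r₁ + d₁ + d₂            ≡⟨ +-comm (9 * r₁ + d₁) d₂ ⟩
  d₂ + (9 * r₁ + d₁)          ≡⟨ cong (λ t → d₂ + t) (9*repdigit+d≡d*10^n d₁ n) ⟩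
  d₂ + d₁ * 10 ^ n            ∎
  where
    open ≡-Reasoning
    r₁ = repdigit d₁ n
    r₂ = repdigit d₂ m
    regroup : ∀ x r a b → 9 * x + a + (9 * r + b) ≡ 9 * (x + r) + a + b
    regroup = solve-∀

module _ (N : ℕ) .{{_ : NonZero N}} where

  %-congˡ-+ : ∀ {a a′} b → a % N ≡ a′ % N → (a + b) % N ≡ (a′ + b) % N
  %-congˡ-+ {a} {a′} b eq = begin
    (a + b) % N          ≡⟨ %-distribˡ-+ a b N ⟩
    (a % N + b % N) % N  ≡⟨ cong (λ t → (t + b % N) % N) eq ⟩
    (a′ % N + b % N) % N ≡⟨ %-distribˡ-+ a′ b N ⟨
    (a′ + b) % N         ∎
    where open ≡-Reasoning

  %-congʳ-+ : ∀ a {b b′} → b % N ≡ b′ % N → (a + b) % N ≡ (a + b′) % N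
  %-congʳ-+ a {b} {b′} eq =
    trans (cong (_% N) (+-comm a b)) (trans (%-congˡ-+ a eq) (cong (_% N) (+-comm b′ a)))

  %-congˡ-* : ∀ {a a′} b → a % N ≡ a′ % N → (a * b) % N ≡ (a′ * b) % N
  %-congˡ-* {a} {a′} b eq = begin
    (a * b) % N            ≡⟨ %-distribˡ-* a b N ⟩
    (a % N * (b % N)) % N  ≡⟨ cong (λ t → (t * (b % N)) % N) eq ⟩
    (a′ % N * (b % N)) % N ≡⟨ %-distribˡ-* a′ b N ⟨
    (a′ * b) % N           ∎
    where open ≡-Reasoning

  %-congʳ-* : ∀ a {b b′} → b % N ≡ b′ % N → (a * b) % N ≡ (a * b′) % N
  %-congʳ-* a {b} {b′} eq =
    trans (cong (_% N) (*-comm a b)) (trans (%-congˡ-* a eq) (cong (_% N) (*-comm b′ a)))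

  reduce-equation : ∀ x d₁ d₂ p q → 9 * x + d₁ + d₂ * p ≡ d₂ + d₁ * q →
                    (9 * (x % N) + d₁ + d₂ * (p % N)) % N ≡ (d₂ + d₁ * (q % N)) % N
  reduce-equation x d₁ d₂ p q eq = begin
    (9 * (x % N) + d₁ + d₂ * (p % N)) % N
      ≡⟨ %-congˡ-+ (d₂ * (p % N)) (%-congˡ-+ d₁ (%-congʳ-* 9 (m%n%n≡m%n x N))) ⟩
    (9 * x + d₁ + d₂ * (p % N)) % N
      ≡⟨ %-congʳ-+ (9 * x + d₁) (%-congʳ-* d₂ (m%n%n≡m%n p N)) ⟩
    (9 * x + d₁ + d₂ * p) % N
      ≡⟨ cong (_% N) eq ⟩
    (d₂ + d₁ * q) % N
      ≡⟨ %-congʳ-+ d₂ (%-congʳ-* d₁ (m%n%n≡m%n q N)) ⟨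
    (d₂ + d₁ * (q % N)) % N
      ∎
    where open ≡-Reasoning

  module LinearRecurrence (a : ℕ) where

    -- pred N * x stands for −x, so the step computes a y − x modulo N without subtraction.
    step : ℕ × ℕ → ℕ × ℕ
    step (x , y) = y , (a * y + pred N * x) % N

    step-% : ∀ {x y z} → z + x ≡ a * y → step (x % N , y % N) ≡ (y % N , z % N)
    step-% {x} {y} {z} eq = cong (y % N ,_) (sym (begin
      z % N                              ≡⟨ [m+kn]%n≡m%n z x N ⟨
      (z + x * N) % N                    ≡⟨ cong (λ t → (z + t) % N) x*N≡x+pred[N]*x ⟩
      (z + (x + pred N * x)) % N         ≡⟨ cong (_% N) (+-assoc z x (pred N * x)) ⟨
      (z + x + pred N * x) % N           ≡⟨ cong (λ t → (t + pred N * x) % N) eq ⟩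
      (a * y + pred N * x) % N           ≡⟨ %-congˡ-+ (pred N * x) (%-congʳ-* a (sym (m%n%n≡m%n y N))) ⟩
      (a * (y % N) + pred N * x) % N     ≡⟨ %-congʳ-+ (a * (y % N)) (%-congʳ-* (pred N) (sym (m%n%n≡m%n x N))) ⟩
      (a * (y % N) + pred N * (x % N)) % N ∎))
      where
        open ≡-Reasoning
        x*N≡x+pred[N]*x : x * N ≡ x + pred N * x
        x*N≡x+pred[N]*x = trans (*-comm x N) (cong (_* x) (sym (suc-pred N)))

    fold-step : (u : ℕ → ℕ) → (∀ k → u (suc (suc k)) + u k ≡ a * u (suc k)) →
                ∀ k → fold (u 0 % N , u 1 % N) step k ≡ (u k % N , u (suc k) % N)
    fold-step u rec zero    = refl
    fold-step u rec (suc k) = trans (cong step (fold-step u rec k)) (step-% (rec k))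

module _ (b N : ℕ) .{{_ : NonZero N}} where

  ^-%-periodic : ∀ s p .{{_ : NonZero p}} → b ^ (s + p) % N ≡ b ^ s % N →
                 ∀ e → b ^ (s + e) % N ≡ b ^ (s + e % p) % N
  ^-%-periodic s p period e = begin
    b ^ (s + e) % N                       ≡⟨ cong (λ t → b ^ (s + t) % N) (m≡m%n+[m/n]*n e p) ⟩
    b ^ (s + (e % p + (e / p) * p)) % N   ≡⟨ shift (e % p) (e / p) ⟩
    b ^ (s + e % p) % N                   ∎
    where
      open ≡-Reasoning
      regroup : ∀ s p r q → s + (r + (p + q * p)) ≡ s + p + (r + q * p)
      regroup = solve-∀
      shift : ∀ r q → b ^ (s + (r + q * p)) % N ≡ b ^ (s + r) % N
      shift r zero    = cong (λ t → b ^ (s + t) % N) (+-identityʳ r)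
      shift r (suc q) = begin
        b ^ (s + (r + suc q * p)) % N        ≡⟨ cong (λ t → b ^ t % N) (regroup s p r q) ⟩
        b ^ (s + p + (r + q * p)) % N        ≡⟨ cong (_% N) (^-distribˡ-+-* b (s + p) _) ⟩
        (b ^ (s + p) * b ^ (r + q * p)) % N  ≡⟨ %-congˡ-* N (b ^ (r + q * p)) period ⟩
        (b ^ s * b ^ (r + q * p)) % N        ≡⟨ cong (_% N) (^-distribˡ-+-* b s _) ⟨
        b ^ (s + (r + q * p)) % N            ≡⟨ shift r q ⟩
        b ^ (s + r) % N                      ∎

  -- The residue of b ^ e is carried along instead of being recomputed for every e.
  allPowers : (lo r n : ℕ) → (ℕ → ℕ → Bool) → Bool
  allPowers lo r zero    P = true
  allPowers lo r (suc n) P = P lo r ∧ allPowers (suc lo) (b * r % N) n P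

  allPowers-sound : ∀ lo n P {r e} → r ≡ b ^ lo % N → T (allPowers lo r n P) →
                    lo ≤ e → e < lo + n → T (P e (b ^ e % N))
  allPowers-sound lo zero    P {e = e} _ _ lo≤e e<lo+0 =
    ⊥-elim (≤⇒≯ lo≤e (subst (e <_) (+-identityʳ lo) e<lo+0))
  allPowers-sound lo (suc n) P {e = e} refl h lo≤e e<lo+n with m≤n⇒m<n∨m≡n lo≤e
  ... | inj₂ refl = proj₁ (Equivalence.to T-∧ h)
  ... | inj₁ lo<e = allPowers-sound (suc lo) n P next (proj₂ (Equivalence.to T-∧ h)) lo<e
                      (subst (e <_) (+-suc lo n) e<lo+n)
    where
      next : b * (b ^ lo % N) % N ≡ b ^ suc lo % N
      next = %-congʳ-* N b (m%n%n≡m%n (b ^ lo) N)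

module _ {a} {A : Set a} (f : A → A) where

  fold-periodic : ∀ {s} p .{{_ : NonZero p}} → fold s f p ≡ s → ∀ k → fold s f k ≡ fold s f (k % p)
  fold-periodic {s} p period k = begin
    fold s f k                              ≡⟨ cong (fold s f) (m≡m%n+[m/n]*n k p) ⟩
    fold s f (k % p + (k / p) * p)          ≡⟨ fold-+ s f (k % p) ⟩
    fold (fold s f ((k / p) * p)) f (k % p) ≡⟨ cong (λ t → fold t f (k % p)) (multiples (k / p)) ⟩
    fold s f (k % p)                        ∎
    where
      open ≡-Reasoning
      multiples : ∀ q → fold s f (q * p) ≡ s
      multiples zero    = refl
      multiples (suc q) = trans (fold-+ s f p) (trans (cong (λ t → fold t f p) (multiples q)) period)

  allOrbit : (A → Bool) → ℕ → A → Bool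
  allOrbit P zero    s = true
  allOrbit P (suc n) s = P s ∧ allOrbit P n (f s)

  -- An equation rather than T (allOrbit P n s): types are reduced before being compared,
  -- so a T-typed certificate would be evaluated again wherever it is used.
  allOrbit-sound : ∀ P {n s j} → allOrbit P n s ≡ true → j < n → T (P (iterate f s j))
  allOrbit-sound P {suc n} {s} {j} h j<n with P s in Ps
  allOrbit-sound P {suc n} {s} {zero}  h _         | true = subst T (sym Ps) _
  allOrbit-sound P {suc n} {s} {suc j} h (s<s j<n) | true = allOrbit-sound P h j<n

allFrom : (lo n : ℕ) → (ℕ → Bool) → Bool
allFrom lo zero    P = true
allFrom lo (suc n) P = P lo ∧ allFrom (suc lo) n P

allFrom-sound : ∀ lo n P {x} → T (allFrom lo n P) → lo ≤ x → x < lo + n → T (P x)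
allFrom-sound lo zero    P {x} _ lo≤x x<lo+0 = ⊥-elim (≤⇒≯ lo≤x (subst (x <_) (+-identityʳ lo) x<lo+0))
allFrom-sound lo (suc n) P {x} h lo≤x x<lo+n with m≤n⇒m<n∨m≡n lo≤x
... | inj₂ refl = proj₁ (Equivalence.to T-∧ h)
... | inj₁ lo<x = allFrom-sound (suc lo) n P (proj₂ (Equivalence.to T-∧ h)) lo<x (subst (x <_) (+-suc lo n) x<lo+n)

_⇒ᵇ_ : Bool → Bool → Bool
true  ⇒ᵇ b = b
false ⇒ᵇ b = true

T-⇒ᵇ : ∀ {a b} → T (a ⇒ᵇ b) → T a → T b
T-⇒ᵇ {true} h _ = h

M : ℕ
M = 4510000

C-step : ℕ × ℕ → ℕ × ℕ
C-step = LinearRecurrence.step M 6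

C-≤ : ∀ k → C k ≤ C (suc k)
C-≤ zero    = s≤s z≤n
C-≤ (suc k) = begin
  C (suc k)                  ≤⟨ m≤n*m (C (suc k)) 5 ⟩
  5 * C (suc k)              ≡⟨ m+n∸m≡n (C (suc k)) (5 * C (suc k)) ⟨
  6 * C (suc k) ∸ C (suc k)  ≤⟨ ∸-monoʳ-≤ (6 * C (suc k)) (C-≤ k) ⟩
  6 * C (suc k) ∸ C k        ∎
  where open ≤-Reasoning

C-rec : ∀ k → C (suc (suc k)) + C k ≡ 6 * C (suc k)
C-rec k = m∸n+n≡m (≤-trans (C-≤ k) (m≤n*m (C (suc k)) 6))

reduceExponent : ℕ → ℕ
reduceExponent (suc (suc (suc (suc j)))) = 4 + j % 10
reduceExponent e = e

10^reduceExponent : ∀ e → 10 ^ e % M ≡ 10 ^ reduceExponent e % M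
10^reduceExponent 0 = refl
10^reduceExponent 1 = refl
10^reduceExponent 2 = refl
10^reduceExponent 3 = refl
10^reduceExponent (suc (suc (suc (suc j)))) = ^-%-periodic 10 M 4 10 refl j

reduceExponent-< : ∀ e → reduceExponent e < 14
reduceExponent-< 0 = z<s
reduceExponent-< 1 = s<s z<s
reduceExponent-< 2 = s<s (s<s z<s)
reduceExponent-< 3 = s<s (s<s (s<s z<s))
reduceExponent-< (suc (suc (suc (suc j)))) = +-monoʳ-< 4 (m%n<n j 10)

reduceExponent-≥ : ∀ {k} e → k ≤ 4 → k ≤ e → k ≤ reduceExponent e
reduceExponent-≥ 0 _ k≤e = k≤e
reduceExponent-≥ 1 _ k≤e = k≤e
reduceExponent-≥ 2 _ k≤e = k≤e
reduceExponent-≥ 3 _ k≤e = k≤e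
reduceExponent-≥ (suc (suc (suc (suc j)))) k≤4 _ = ≤-trans k≤4 (m≤m+n 4 (j % 10))

reduceExponent≡2⇒≡2 : ∀ e → reduceExponent e ≡ 2 → e ≡ 2
reduceExponent≡2⇒≡2 2 _ = refl
reduceExponent≡2⇒≡2 0 ()
reduceExponent≡2⇒≡2 1 ()
reduceExponent≡2⇒≡2 3 ()
reduceExponent≡2⇒≡2 (suc (suc (suc (suc j)))) ()

-- rₙ and rₘ stand for the residues of 10 ^ n and 10 ^ m.
congruent : (c d₁ d₂ rₙ rₘ : ℕ) → Bool
congruent c d₁ d₂ rₙ rₘ = (9 * c + d₁ + d₂ * rₘ) % M ≡ᵇ (d₂ + d₁ * rₙ) % M

exceptional : (n d₁ d₂ : ℕ) → Bool
exceptional n d₁ d₂ = (n ≡ᵇ 2) ∧ ((d₁ ≡ᵇ 1) ∧ (d₂ ≡ᵇ 8) ∨ (d₁ ≡ᵇ 2) ∧ (d₂ ≡ᵇ 5))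

sieveM : (c d₁ d₂ n rₙ : ℕ) → Bool
sieveM c d₁ d₂ n rₙ = allPowers 10 M 1 (10 ^ 1 % M) 13 λ m rₘ → congruent c d₁ d₂ rₙ rₘ ⇒ᵇ exceptional n d₁ d₂

sieveNM : (c d₁ d₂ : ℕ) → Bool
sieveNM c d₁ d₂ = allPowers 10 M 2 (10 ^ 2 % M) 12 (sieveM c d₁ d₂)

-- The last-digit test only prunes: congruence modulo M implies it, as 10 ∣ M.
sieveD₂ : (c d₁ : ℕ) → Bool
sieveD₂ c d₁ = allFrom 1 9 λ d₂ → ((9 * c + d₁) % 10 ≡ᵇ d₂) ⇒ᵇ sieveNM c d₁ d₂

sieve : ℕ → Bool
sieve c = allFrom 1 9 (sieveD₂ c)

sieve-sound : ∀ c {d₁ d₂ n m} → T (sieve c) →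
              1 ≤ d₁ → d₁ ≤ 9 → 1 ≤ d₂ → d₂ ≤ 9 → (9 * c + d₁) % 10 ≡ d₂ →
              2 ≤ n → n < 14 → 1 ≤ m → m < 14 →
              T (congruent c d₁ d₂ (10 ^ n % M) (10 ^ m % M)) → T (exceptional n d₁ d₂)
sieve-sound c {d₁} {d₂} {n} {m} h 1≤d₁ d₁≤9 1≤d₂ d₂≤9 last 2≤n n<14 1≤m m<14 =
  T-⇒ᵇ (allPowers-sound 10 M 1 13 (λ _ rₘ → congruent c d₁ d₂ (10 ^ n % M) rₘ ⇒ᵇ exceptional n d₁ d₂)
                        refl row 1≤m m<14)
  where
    digits : T (((9 * c + d₁) % 10 ≡ᵇ d₂) ⇒ᵇ sieveNM c d₁ d₂)
    digits = allFrom-sound 1 9 (λ d₂ → ((9 * c + d₁) % 10 ≡ᵇ d₂) ⇒ᵇ sieveNM c d₁ d₂)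
               (allFrom-sound 1 9 (sieveD₂ c) h 1≤d₁ (s≤s d₁≤9)) 1≤d₂ (s≤s d₂≤9)
    row : T (sieveM c d₁ d₂ n (10 ^ n % M))
    row = allPowers-sound 10 M 2 12 (sieveM c d₁ d₂) refl (T-⇒ᵇ digits (≡⇒≡ᵇ _ d₂ last)) 2≤n n<14

sieveFst : ℕ × ℕ → Bool
sieveFst (c , _) = sieve c

sieve-orbit : allOrbit C-step sieveFst 1500 (1 , 3) ≡ true
sieve-orbit = refl

C-step-period : fold (1 , 3) C-step 1500 ≡ (1 , 3)
C-step-period = refl

sieve-C : ∀ k → T (sieve (C k % M))
sieve-C k = subst (T ∘ sieve) (sym residue) point
  where
    open ≡-Reasoning
    point : T (sieveFst (iterate C-step (1 , 3) (k % 1500)))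
    point = allOrbit-sound C-step sieveFst {1500} {1 , 3} sieve-orbit (m%n<n k 1500)
    residue : C k % M ≡ proj₁ (iterate C-step (1 , 3) (k % 1500))
    residue = begin
      C k % M                                   ≡⟨ cong proj₁ (LinearRecurrence.fold-step M 6 C C-rec k) ⟨
      proj₁ (fold (1 , 3) C-step k)             ≡⟨ cong proj₁ (fold-periodic C-step {1 , 3} 1500 C-step-period k) ⟩
      proj₁ (fold (1 , 3) C-step (k % 1500))    ≡⟨ cong proj₁ (iterate-is-fold (1 , 3) C-step (k % 1500)) ⟩
      proj₁ (iterate C-step (1 , 3) (k % 1500)) ∎

last-digit : ∀ x {d₁ d₂ m n} → 1 ≤ m → 1 ≤ n → d₂ < 10 →
             9 * x + d₁ + d₂ * 10 ^ m ≡ d₂ + d₁ * 10 ^ n → (9 * (x % M) + d₁) % 10 ≡ d₂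
last-digit x {d₁} {d₂} {suc m} {suc n} _ _ d₂<10 eq = begin
  (9 * (x % M) + d₁) % 10              ≡⟨ %-congˡ-+ 10 {9 * (x % M)} {9 * x} d₁ (%-congʳ-* 10 9 {x % M} {x}
                                            (m∣n⇒o%n%m≡o%m 10 M x (divides 451000 refl))) ⟩
  (9 * x + d₁) % 10                    ≡⟨ %-remove-+ʳ (9 * x + d₁) (∣n⇒∣m*n d₂ (m∣m*n (10 ^ m))) ⟨
  (9 * x + d₁ + d₂ * 10 ^ suc m) % 10  ≡⟨ cong (_% 10) eq ⟩
  (d₂ + d₁ * 10 ^ suc n) % 10          ≡⟨ %-remove-+ʳ d₂ (∣n⇒∣m*n d₁ (m∣m*n (10 ^ n))) ⟩
  d₂ % 10                              ≡⟨ m<n⇒m%n≡m d₂<10 ⟩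
  d₂                                   ∎
  where open ≡-Reasoning

equation⇒congruent : ∀ x d₁ d₂ m n → 9 * x + d₁ + d₂ * 10 ^ m ≡ d₂ + d₁ * 10 ^ n →
                      T (congruent (x % M) d₁ d₂ (10 ^ reduceExponent n % M) (10 ^ reduceExponent m % M))
equation⇒congruent x d₁ d₂ m n eq =
  subst₂ (λ rₙ rₘ → T (congruent (x % M) d₁ d₂ rₙ rₘ)) (10^reduceExponent n) (10^reduceExponent m)
         (≡⇒≡ᵇ _ _ (reduce-equation M x d₁ d₂ (10 ^ m) (10 ^ n) eq))

exceptional-spec : ∀ n d₁ d₂ → T (exceptional n d₁ d₂) →
                   n ≡ 2 × (d₁ ≡ 1 × d₂ ≡ 8 ⊎ d₁ ≡ 2 × d₂ ≡ 5)
exceptional-spec n d₁ d₂ h =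
  Product.map (≡ᵇ⇒≡ n 2) (Sum.map (digits 1 8) (digits 2 5) ∘ Equivalence.to T-∨) (Equivalence.to T-∧ h)
  where
    digits : ∀ a b → T ((d₁ ≡ᵇ a) ∧ (d₂ ≡ᵇ b)) → d₁ ≡ a × d₂ ≡ b
    digits a b = Product.map (≡ᵇ⇒≡ d₁ a) (≡ᵇ⇒≡ d₂ b) ∘ Equivalence.to T-∧

two-digit-minuend : ∀ x {m d₁ d₂} → 1 ≤ m → d₁ < d₂ → d₂ ≤ 9 →
                    9 * x + d₁ + d₂ * 10 ^ m ≡ d₂ + d₁ * 10 ^ 2 → x + d₂ ≡ 11 * d₁
two-digit-minuend x {1} {d₁} {d₂} _ _ _ eq =
  *-cancelˡ-≡ _ _ 9 (+-cancelʳ-≡ (d₁ + d₂) _ _ (trans (expand x d₁ d₂) (trans eq (collect d₁ d₂))))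
  where
    expand : ∀ x a b → 9 * (x + b) + (a + b) ≡ 9 * x + a + b * 10
    expand = solve-∀
    collect : ∀ a b → b + a * 100 ≡ 9 * (11 * a) + (a + b)
    collect = solve-∀
two-digit-minuend x {suc (suc m)} {d₁} {d₂} _ d₁<d₂ d₂≤9 eq = ⊥-elim (<-irrefl refl (begin-strict
  d₂ + d₁ * 100                       <⟨ +-monoˡ-< (d₁ * 100) (≤-trans (s≤s d₂≤9) (m≤m+n 10 90)) ⟩
  100 + d₁ * 100                      ≤⟨ *-monoˡ-≤ 100 d₁<d₂ ⟩
  d₂ * 100                            ≤⟨ *-monoʳ-≤ d₂ (^-monoʳ-≤ 10 (m≤m+n 2 m)) ⟩
  d₂ * 10 ^ (2 + m)                   ≤⟨ m≤n+m _ (9 * x + d₁) ⟩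
  9 * x + d₁ + d₂ * 10 ^ (2 + m)      ≡⟨ eq ⟩
  d₂ + d₁ * 100                       ∎))
  where open ≤-Reasoning

two-digit-cases : ∀ x {m d₁ d₂} → 1 ≤ m → d₂ ≤ 9 → d₁ ≡ 1 × d₂ ≡ 8 ⊎ d₁ ≡ 2 × d₂ ≡ 5 →
                  9 * x + d₁ + d₂ * 10 ^ m ≡ d₂ + d₁ * 10 ^ 2 → x ≡ 3 ⊎ x ≡ 17
two-digit-cases x 1≤m d₂≤9 (inj₁ (refl , refl)) eq =
  inj₁ (+-cancelʳ-≡ 8 _ _ (two-digit-minuend x 1≤m (s≤s (s≤s z≤n)) d₂≤9 eq))
two-digit-cases x 1≤m d₂≤9 (inj₂ (refl , refl)) eq =
  inj₂ (+-cancelʳ-≡ 5 _ _ (two-digit-minuend x 1≤m (s≤s (s≤s (s≤s z≤n))) d₂≤9 eq))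

theorem3 : (k m n d₁ d₂ : ℕ) → 1 ≤ k → 1 ≤ m → n ≥ 2 →
    1 ≤ d₁ → d₁ ≤ 9 → 1 ≤ d₂ → d₂ ≤ 9 →
    + C k ≡ + repdigit d₁ n - + repdigit d₂ m →
    C k ≡ 3 ⊎ C k ≡ 17
theorem3 k m n d₁ d₂ _ 1≤m 2≤n 1≤d₁ d₁≤9 1≤d₂ d₂≤9 eq =
  two-digit-cases (C k) 1≤m d₂≤9 digits (subst (λ e → 9 * C k + d₁ + d₂ * 10 ^ m ≡ d₂ + d₁ * 10 ^ e) n≡2 equation)
  where
    equation : 9 * C k + d₁ + d₂ * 10 ^ m ≡ d₂ + d₁ * 10 ^ n
    equation = repdigit-difference (C k) d₁ d₂ m n eq
    exception : T (exceptional (reduceExponent n) d₁ d₂)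
    exception = sieve-sound (C k % M) (sieve-C k) 1≤d₁ d₁≤9 1≤d₂ d₂≤9
      (last-digit (C k) 1≤m (≤-trans (s≤s z≤n) 2≤n) (s≤s d₂≤9) equation)
      (reduceExponent-≥ n (s≤s (s≤s z≤n)) 2≤n) (reduceExponent-< n)
      (reduceExponent-≥ m (s≤s z≤n) 1≤m) (reduceExponent-< m)
      (equation⇒congruent (C k) d₁ d₂ m n equation)
    n≡2 : n ≡ 2
    n≡2 = reduceExponent≡2⇒≡2 n (proj₁ (exceptional-spec (reduceExponent n) d₁ d₂ exception))
    digits : d₁ ≡ 1 × d₂ ≡ 8 ⊎ d₁ ≡ 2 × d₂ ≡ 5
    digits = proj₂ (exceptional-spec (reduceExponent n) d₁ d₂ exception)
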